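{- Let $G$ be a graph and let $\{\hat C,\hat I,\hat Q\}$ be a partition of $V(G)$ (parts possibly empty) with the following properties: (1) $\hat C$ is a clique and $\hat I$ is an independent set; (2) $\hat Q$ is a clique or an independent set, and $|\hat Q|\ge 2$; (3) every vertex in $\hat Q$ is adjacent to every vertex in $\hat C$ and non-adjacent to every vertex in $\hat I$; (4) if $\hat Q$ is a clique, then every vertex in $\hat C$ has a neighbor in $\hat I$; (5) if $\hat Q$ is an independent set, then every vertex in $\hat I$ has a non-neighbor in $\hat C$. Then $G$ is a split graph, and $\hat C$ is its always-clique set, $\hat I$ its always-independent set, and $\hat Q$ its questioning set.
   Context: A split graph is a graph whose vertex set can be partitioned into a clique and an independent set (parts may be empty); such an ordered pair $(C',I')$ (clique, independent set) is a split partition. For a split graph $G$: the always-clique set is the set of vertices lying in the clique of every split partition; the always-independent set is the set of vertices lying in the independent set of every split partition; the questioning set is the set of vertices $v$ for which some split partition places $v$ in the clique and some split partition places $v$ in the independent set. -}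

module Defs where

open import Data.Nat using (ℕ)
open import Data.Bool using (Bool; true; false)
open import Data.Fin using (Fin)
open import Data.Product using (Σ; _×_; ∃)
open import Data.Empty using (⊥)
open import Data.Sum using (_⊎_)
open import Relation.Nullary using (¬_; Dec)
open import Relation.Binary.PropositionalEquality using (_≡_)
open import Level using (0ℓ) renaming (suc to lsuc)

record Graph (n : ℕ) : Set₁ where
  field
    Adj     : Fin n → Fin n → Set
    sym     : ∀ {u v} → Adj u v → Adj v u
    irrefl  : ∀ {v} → ¬ Adj v v
    Adj?    : ∀ u v → Dec (Adj u v)
open Graph public

VSet : ℕ → Set₁
VSet n = Fin n → Set

IsClique : ∀ {n} → Graph n → VSet n → Set
IsClique G S = ∀ u v → S u → S v → ¬ u ≡ v → Adj G u v

IsIndependent : ∀ {n} → Graph n → VSet n → Set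
IsIndependent G S = ∀ u v → S u → S v → ¬ Adj G u v

InClique : ∀ {n} → (Fin n → Bool) → VSet n
InClique side v = side v ≡ true

InIndep : ∀ {n} → (Fin n → Bool) → VSet n
InIndep side v = side v ≡ false

record SplitPartition {n} (G : Graph n) : Set where
  field
    side   : Fin n → Bool
    clique : IsClique G (InClique side)
    indep  : IsIndependent G (InIndep side)

open SplitPartition public

Cl : ∀ {n} {G : Graph n} → SplitPartition G → VSet n
Cl P = InClique (side P)

Ind : ∀ {n} {G : Graph n} → SplitPartition G → VSet n
Ind P = InIndep (side P)

IsSplit : ∀ {n} → Graph n → Set
IsSplit G = SplitPartition G

AlwaysClique : ∀ {n} → Graph n → VSet n
AlwaysClique G v = (P : SplitPartition G) → Cl P v

AlwaysIndependent : ∀ {n} → Graph n → VSet n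
AlwaysIndependent G v = (P : SplitPartition G) → Ind P v

Questioning : ∀ {n} → Graph n → VSet n
Questioning G v = Σ (SplitPartition G) (λ P → Cl P v) × Σ (SplitPartition G) (λ P → Ind P v)

_≐_ : ∀ {n} → VSet n → VSet n → Set
A ≐ B = ∀ v → (A v → B v) × (B v → A v)

data Part : Set where
  pC pI pQ : Part

Lab : ∀ {n} → (Fin n → Part) → Part → VSet n
Lab f p v = f v ≡ p

{-# OPTIONS --safe #-}
-- Every split partition must put a vertex with two distinct non-adjacent neighbours into
-- the clique, and a vertex with two adjacent non-neighbours (or a non-neighbour that is
-- always in the clique) into the independent set. Each vertex of Ĉ is such a vertex of
-- the first kind, witnessed by Q̂ (if Q̂ is independent) or by Q̂ and its neighbour in Î
-- (if Q̂ is a clique), and dually for Î. Every q ∈ Q̂ is on both sides of some split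
-- partition: (Ĉ ∪ Q̂, Î) and (Ĉ, Î ∪ Q̂) are split partitions when Q̂ is a clique,
-- respectively independent, and q can be moved to the other side since it is complete
-- to Ĉ and anticomplete to Î. As the always-clique, always-independent and questioning
-- sets are pairwise disjoint, the three inclusions are equalities.
module Submission where

open import Defs
open import Data.Bool using (Bool; true; false)
open import Data.Fin using (Fin)
open import Data.Fin.Properties using (_≟_)
open import Data.Vec.Functional using (updateAt)
open import Data.Vec.Functional.Properties using (updateAt-updates; updateAt-minimal)
open import Data.Product using (Σ; _×_; _,_; proj₁)
open import Data.Sum using (_⊎_; inj₁; inj₂; [_,_]′)
open import Data.Empty using (⊥; ⊥-elim)
open import Function using (_∘_; const)
open import Relation.Nullary using (¬_; yes; no; contradiction)
open import Relation.Unary using (_⊆_; _∪_; ｛_｝) renaming (_⊥_ to Disjoint)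
open import Relation.Binary.PropositionalEquality
  using (_≡_; refl; trans; cong) renaming (sym to ≡-sym)

Complete : ∀ {n} → Graph n → VSet n → VSet n → Set
Complete G A B = ∀ u v → A u → B v → Adj G u v

Anticomplete : ∀ {n} → Graph n → VSet n → VSet n → Set
Anticomplete G A B = ∀ u v → A u → B v → ¬ Adj G u v

not-both-true-and-false : ∀ {b : Bool} → b ≡ true → b ≡ false → ⊥
not-both-true-and-false refl ()

distinct-labels⇒distinct : ∀ {A B : Set} (f : A → B) {u v p q} →
  f u ≡ p → f v ≡ q → ¬ p ≡ q → ¬ u ≡ v
distinct-labels⇒distinct f fu≡p fv≡q p≢q refl = p≢q (trans (≡-sym fu≡p) fv≡q)

updateAt-≡ : ∀ {n} {A : Set} (s : Fin n → A) (q : Fin n) {v} {x y : A} →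
  updateAt s q (const x) v ≡ y → q ≡ v ⊎ s v ≡ y
updateAt-≡ s q {v} e with v ≟ q
... | yes refl = inj₁ refl
... | no v≢q   = inj₂ (trans (≡-sym (updateAt-minimal v q s v≢q)) e)

module _ {n} (G : Graph n) where

  complete-sym : ∀ {A B} → Complete G A B → Complete G B A
  complete-sym AB u v u∈B v∈A = sym G (AB v u v∈A u∈B)

  anticomplete-sym : ∀ {A B} → Anticomplete G A B → Anticomplete G B A
  anticomplete-sym AB u v u∈B v∈A = AB v u v∈A u∈B ∘ sym G

  ∪-isClique : ∀ {A B} → IsClique G A → IsClique G B → Complete G A B → IsClique G (A ∪ B)
  ∪-isClique cA cB AB u v (inj₁ u∈A) (inj₁ v∈A) u≢v = cA u v u∈A v∈A u≢v
  ∪-isClique cA cB AB u v (inj₁ u∈A) (inj₂ v∈B) _   = AB u v u∈A v∈B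
  ∪-isClique cA cB AB u v (inj₂ u∈B) (inj₁ v∈A) _   = complete-sym AB u v u∈B v∈A
  ∪-isClique cA cB AB u v (inj₂ u∈B) (inj₂ v∈B) u≢v = cB u v u∈B v∈B u≢v

  ∪-isIndependent : ∀ {A B} → IsIndependent G A → IsIndependent G B → Anticomplete G A B →
    IsIndependent G (A ∪ B)
  ∪-isIndependent iA iB AB u v (inj₁ u∈A) (inj₁ v∈A) = iA u v u∈A v∈A
  ∪-isIndependent iA iB AB u v (inj₁ u∈A) (inj₂ v∈B) = AB u v u∈A v∈B
  ∪-isIndependent iA iB AB u v (inj₂ u∈B) (inj₁ v∈A) = anticomplete-sym AB u v u∈B v∈A
  ∪-isIndependent iA iB AB u v (inj₂ u∈B) (inj₂ v∈B) = iB u v u∈B v∈B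

  singleton-isClique : ∀ q → IsClique G ｛ q ｝
  singleton-isClique q u v refl refl u≢v = contradiction refl u≢v

  singleton-isIndependent : ∀ q → IsIndependent G ｛ q ｝
  singleton-isIndependent q u v refl refl = irrefl G

module _ {n} {G : Graph n} where

  splitPartition : (s : Fin n → Bool) {K J : VSet n} → IsClique G K → IsIndependent G J →
    InClique s ⊆ K → InIndep s ⊆ J → SplitPartition G
  splitPartition s cK iJ s⊆K s⊆J = record
    { side   = s
    ; clique = λ u v u∈ v∈ → cK u v (s⊆K u∈) (s⊆K v∈)
    ; indep  = λ u v u∈ v∈ → iJ u v (s⊆J u∈) (s⊆J v∈)
    }

  module _ (P : SplitPartition G) where

    neighbour-of-independent-in-clique : ∀ {u v} → Ind P u → Adj G u v → Cl P v
    neighbour-of-independent-in-clique {u} {v} u∈I uv with side P v in eq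
    ... | true  = refl
    ... | false = contradiction uv (indep P u v u∈I eq)

    nonNeighbour-of-clique-in-independent : ∀ {u v} → Cl P u → ¬ Adj G u v → ¬ u ≡ v → Ind P v
    nonNeighbour-of-clique-in-independent {u} {v} u∈C ¬uv u≢v with side P v in eq
    ... | true  = contradiction (clique P u v u∈C eq u≢v) ¬uv
    ... | false = refl

    moveToIndependent : ∀ q → (∀ v → Ind P v → ¬ Adj G q v) → Σ (SplitPartition G) (λ P′ → Ind P′ q)
    moveToIndependent q q-isolated =
      splitPartition s (clique P) (∪-isIndependent G (singleton-isIndependent G q) (indep P) q-Ind)
        stays-in-clique (updateAt-≡ (side P) q)
      , updateAt-updates q (side P)
      where
      s : Fin n → Bool
      s = updateAt (side P) q (const false)
      q-Ind : Anticomplete G ｛ q ｝ (Ind P)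
      q-Ind _ v refl = q-isolated v
      stays-in-clique : InClique s ⊆ Cl P
      stays-in-clique {v} e with updateAt-≡ (side P) q e
      ... | inj₁ refl = ⊥-elim (not-both-true-and-false e (updateAt-updates q (side P)))
      ... | inj₂ v∈C  = v∈C

    moveToClique : ∀ q → (∀ v → Cl P v → Adj G q v) → Σ (SplitPartition G) (λ P′ → Cl P′ q)
    moveToClique q q-universal =
      splitPartition s (∪-isClique G (singleton-isClique G q) (clique P) q-Cl) (indep P)
        (updateAt-≡ (side P) q) stays-in-independent
      , updateAt-updates q (side P)
      where
      s : Fin n → Bool
      s = updateAt (side P) q (const true)
      q-Cl : Complete G ｛ q ｝ (Cl P)
      q-Cl _ v refl = q-universal v
      stays-in-independent : InIndep s ⊆ Ind P
      stays-in-independent {v} e with updateAt-≡ (side P) q e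
      ... | inj₁ refl = ⊥-elim (not-both-true-and-false (updateAt-updates q (side P)) e)
      ... | inj₂ v∈I  = v∈I

  twoNonadjacentNeighbours⇒alwaysClique : ∀ {u x y} → Adj G u x → Adj G u y → ¬ x ≡ y →
    ¬ Adj G x y → AlwaysClique G u
  twoNonadjacentNeighbours⇒alwaysClique {u} {x} {y} ux uy x≢y ¬xy P with side P u in eq
  ... | true  = refl
  ... | false = contradiction (clique P x y (in-clique ux) (in-clique uy) x≢y) ¬xy
    where
    in-clique : ∀ {v} → Adj G u v → Cl P v
    in-clique = neighbour-of-independent-in-clique P eq

  twoAdjacentNonNeighbours⇒alwaysIndependent : ∀ {u x y} → ¬ Adj G u x → ¬ Adj G u y →
    Adj G x y → AlwaysIndependent G u
  twoAdjacentNonNeighbours⇒alwaysIndependent {u} {x} {y} ¬ux ¬uy xy P with side P u in eq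
  ... | true  = contradiction xy (indep P x y (in-independent ¬ux u≢x) (in-independent ¬uy u≢y))
    where
    in-independent : ∀ {v} → ¬ Adj G u v → ¬ u ≡ v → Ind P v
    in-independent = nonNeighbour-of-clique-in-independent P eq
    u≢x : ¬ u ≡ x
    u≢x refl = ¬uy xy
    u≢y : ¬ u ≡ y
    u≢y refl = ¬ux (sym G xy)
  ... | false = refl

  nonNeighbour-of-alwaysClique⇒alwaysIndependent : ∀ {u c} → AlwaysClique G c → ¬ Adj G u c →
    ¬ u ≡ c → AlwaysIndependent G u
  nonNeighbour-of-alwaysClique⇒alwaysIndependent {u} {c} c∈C ¬uc u≢c P with side P u in eq
  ... | true  = contradiction (clique P u c eq (c∈C P) u≢c) ¬uc
  ... | false = refl

  alwaysClique-disjoint-alwaysIndependent : SplitPartition G →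
    Disjoint (AlwaysClique G) (AlwaysIndependent G)
  alwaysClique-disjoint-alwaysIndependent P (v∈C , v∈I) = not-both-true-and-false (v∈C P) (v∈I P)

  alwaysClique-disjoint-questioning : Disjoint (AlwaysClique G) (Questioning G)
  alwaysClique-disjoint-questioning (v∈C , _ , (P , v∈I)) = not-both-true-and-false (v∈C P) v∈I

  alwaysIndependent-disjoint-questioning : Disjoint (AlwaysIndependent G) (Questioning G)
  alwaysIndependent-disjoint-questioning (v∈I , (P , v∈C) , _) = not-both-true-and-false v∈C (v∈I P)

module _ {n} (part : Fin n → Part) {X Y Z : VSet n}
  (C⊆X : Lab part pC ⊆ X) (I⊆Y : Lab part pI ⊆ Y) (Q⊆Z : Lab part pQ ⊆ Z)
  (X⊥Y : Disjoint X Y) (X⊥Z : Disjoint X Z) (Y⊥Z : Disjoint Y Z) where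

  private
    X⊆C : X ⊆ Lab part pC
    X⊆C {v} v∈X with part v in eq
    ... | pC = refl
    ... | pI = ⊥-elim (X⊥Y (v∈X , I⊆Y eq))
    ... | pQ = ⊥-elim (X⊥Z (v∈X , Q⊆Z eq))

    Y⊆I : Y ⊆ Lab part pI
    Y⊆I {v} v∈Y with part v in eq
    ... | pC = ⊥-elim (X⊥Y (C⊆X eq , v∈Y))
    ... | pI = refl
    ... | pQ = ⊥-elim (Y⊥Z (v∈Y , Q⊆Z eq))

    Z⊆Q : Z ⊆ Lab part pQ
    Z⊆Q {v} v∈Z with part v in eq
    ... | pC = ⊥-elim (X⊥Z (C⊆X eq , v∈Z))
    ... | pI = ⊥-elim (Y⊥Z (I⊆Y eq , v∈Z))
    ... | pQ = refl

  disjoint-covers-of-labels-≐ : (X ≐ Lab part pC) × (Y ≐ Lab part pI) × (Z ≐ Lab part pQ)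
  disjoint-covers-of-labels-≐ =
    (λ v → X⊆C , C⊆X) , (λ v → Y⊆I , I⊆Y) , (λ v → Z⊆Q , Q⊆Z)

withQInClique : Part → Bool
withQInClique pC = true
withQInClique pI = false
withQInClique pQ = true

withQInIndependent : Part → Bool
withQInIndependent pC = true
withQInIndependent pI = false
withQInIndependent pQ = false

withQInClique-true : ∀ p → withQInClique p ≡ true → p ≡ pC ⊎ p ≡ pQ
withQInClique-true pC _ = inj₁ refl
withQInClique-true pQ _ = inj₂ refl

withQInClique-false : ∀ p → withQInClique p ≡ false → p ≡ pI
withQInClique-false pI _ = refl

withQInIndependent-true : ∀ p → withQInIndependent p ≡ true → p ≡ pC
withQInIndependent-true pC _ = refl

withQInIndependent-false : ∀ p → withQInIndependent p ≡ false → p ≡ pI ⊎ p ≡ pQ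
withQInIndependent-false pI _ = inj₁ refl
withQInIndependent-false pQ _ = inj₂ refl

module SplitWitness {n} (G : Graph n) (part : Fin n → Part)
  (C-clique : IsClique G (Lab part pC)) (I-independent : IsIndependent G (Lab part pI))
  (Q-type : IsClique G (Lab part pQ) ⊎ IsIndependent G (Lab part pQ))
  {a b : Fin n} (a∈Q : Lab part pQ a) (b∈Q : Lab part pQ b) (a≢b : ¬ a ≡ b)
  (Q-C : Complete G (Lab part pQ) (Lab part pC))
  (Q-I : Anticomplete G (Lab part pQ) (Lab part pI))
  (C-dominated : IsClique G (Lab part pQ) →
    ∀ c → Lab part pC c → Σ (Fin n) (λ i → Lab part pI i × Adj G c i))
  (I-undominated : IsIndependent G (Lab part pQ) →
    ∀ i → Lab part pI i → Σ (Fin n) (λ c → Lab part pC c × ¬ Adj G i c))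
  where

  private
    C I Q : VSet n
    C = Lab part pC
    I = Lab part pI
    Q = Lab part pQ

  C⊆AlwaysClique : C ⊆ AlwaysClique G
  C⊆AlwaysClique {c} c∈C = [ through-I-neighbour , through-Q ]′ Q-type
    where
    c-Q : ∀ {q} → Q q → Adj G c q
    c-Q {q} q∈Q = sym G (Q-C q c q∈Q c∈C)
    through-I-neighbour : IsClique G Q → AlwaysClique G c
    through-I-neighbour Q-clique =
      let (i , i∈I , ci) = C-dominated Q-clique c c∈C in
      twoNonadjacentNeighbours⇒alwaysClique (c-Q a∈Q) ci
        (distinct-labels⇒distinct part a∈Q i∈I λ ()) (Q-I a i a∈Q i∈I)
    through-Q : IsIndependent G Q → AlwaysClique G c
    through-Q Q-independent =
      twoNonadjacentNeighbours⇒alwaysClique (c-Q a∈Q) (c-Q b∈Q) a≢b (Q-independent a b a∈Q b∈Q)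

  I⊆AlwaysIndependent : I ⊆ AlwaysIndependent G
  I⊆AlwaysIndependent {i} i∈I = [ through-Q , through-C-nonNeighbour ]′ Q-type
    where
    through-Q : IsClique G Q → AlwaysIndependent G i
    through-Q Q-clique =
      twoAdjacentNonNeighbours⇒alwaysIndependent (i-Q a∈Q) (i-Q b∈Q) (Q-clique a b a∈Q b∈Q a≢b)
      where
      i-Q : ∀ {q} → Q q → ¬ Adj G i q
      i-Q {q} q∈Q = Q-I q i q∈Q i∈I ∘ sym G
    through-C-nonNeighbour : IsIndependent G Q → AlwaysIndependent G i
    through-C-nonNeighbour Q-independent =
      let (c , c∈C , ¬ic) = I-undominated Q-independent i i∈I in
      nonNeighbour-of-alwaysClique⇒alwaysIndependent (C⊆AlwaysClique c∈C) ¬ic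
        (distinct-labels⇒distinct part i∈I c∈C λ ())

  Q⊆Questioning : Q ⊆ Questioning G
  Q⊆Questioning {q} q∈Q = [ from-clique-side , from-independent-side ]′ Q-type
    where
    from-clique-side : IsClique G Q → Questioning G q
    from-clique-side Q-clique =
      (P , cong withQInClique q∈Q) ,
      moveToIndependent P q (λ v v∈I → Q-I q v q∈Q (withQInClique-false (part v) v∈I))
      where
      C∪Q-clique : IsClique G (C ∪ Q)
      C∪Q-clique = ∪-isClique G C-clique Q-clique (complete-sym G Q-C)
      P : SplitPartition G
      P = splitPartition (withQInClique ∘ part)
            C∪Q-clique I-independent
            (λ {v} → withQInClique-true (part v)) (λ {v} → withQInClique-false (part v))
    from-independent-side : IsIndependent G Q → Questioning G q
    from-independent-side Q-independent =
      moveToClique P q (λ v v∈C → Q-C q v q∈Q (withQInIndependent-true (part v) v∈C)) ,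
      (P , cong withQInIndependent q∈Q)
      where
      I∪Q-independent : IsIndependent G (I ∪ Q)
      I∪Q-independent = ∪-isIndependent G I-independent Q-independent (anticomplete-sym G Q-I)
      P : SplitPartition G
      P = splitPartition (withQInIndependent ∘ part)
            C-clique I∪Q-independent
            (λ {v} → withQInIndependent-true (part v)) (λ {v} → withQInIndependent-false (part v))

lemma7p6 : ∀ {n} (G : Graph n) (part : Fin n → Part) →
    IsClique G (Lab part pC) → IsIndependent G (Lab part pI) →
    (IsClique G (Lab part pQ) ⊎ IsIndependent G (Lab part pQ)) →
    Σ (Fin n) (λ a → Σ (Fin n) (λ b → Lab part pQ a × Lab part pQ b × ¬ a ≡ b)) →
    (∀ q c → Lab part pQ q → Lab part pC c → Adj G q c) →
    (∀ q i → Lab part pQ q → Lab part pI i → ¬ Adj G q i) →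
    (IsClique G (Lab part pQ) → ∀ c → Lab part pC c → Σ (Fin n) (λ i → Lab part pI i × Adj G c i)) →
    (IsIndependent G (Lab part pQ) → ∀ i → Lab part pI i → Σ (Fin n) (λ c → Lab part pC c × ¬ Adj G i c)) →
    IsSplit G × (AlwaysClique G ≐ Lab part pC) × (AlwaysIndependent G ≐ Lab part pI) × (Questioning G ≐ Lab part pQ)
lemma7p6 G part hC hI hQ (a , b , a∈Q , b∈Q , a≢b) hQC hQI h4 h5 =
  P , disjoint-covers-of-labels-≐ part C⊆AlwaysClique I⊆AlwaysIndependent Q⊆Questioning
        (alwaysClique-disjoint-alwaysIndependent P)
        alwaysClique-disjoint-questioning
        alwaysIndependent-disjoint-questioning
  where
  open SplitWitness G part hC hI hQ a∈Q b∈Q a≢b hQC hQI h4 h5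
  P : SplitPartition G
  P = proj₁ (proj₁ (Q⊆Questioning a∈Q))
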